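{- Fix $n\in\mathbb{N}$. Simple trees are finite trees whose nodes are of the form $N_k$, a node of arity (number of children) $k$, for $0\le k\le n$. Set $T_0 = N_0$, and for $k>0$ let $T_k$ be the tree with root $N_k$ and $k$ copies of $T_{k-1}$ as children. The size $\sharp t$ of a simple tree is its number of nodes and its depth is the maximal number of nodes on a path. Let $\mathsf{Trees}(n)$ be the set of simple trees of depth $\le n+1$ having, for each $2\le k\le n$, exactly $\frac{n!}{k!}$ nodes $N_k$, and arbitrarily many nodes $N_1$ and $N_0$. Let $t \in \mathsf{Trees}(n)$ be of maximal size. Then $t = T_n$. -}

module Defs where

open import Data.Nat using (ℕ; zero; suc; _+_; _≤_; _⊔_; _!; _/_)
open import Data.Nat.Properties using (≤-trans; n≤1+n; _!≢0)
open import Data.Vec using (Vec; []; _∷_; replicate)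
open import Data.Product using (_×_)
open import Relation.Nullary using (yes; no)
open import Data.Nat using (_≟_)
open import Relation.Binary.PropositionalEquality using (_≡_)

data Tree (n : ℕ) : Set where
  node : (k : ℕ) → k ≤ n → Vec (Tree n) k → Tree n

mutual
  size : ∀ {n} → Tree n → ℕ
  size (node k _ ts) = suc (sizes ts)

  sizes : ∀ {n m} → Vec (Tree n) m → ℕ
  sizes [] = 0
  sizes (t ∷ ts) = size t + sizes ts

mutual
  depth : ∀ {n} → Tree n → ℕ
  depth (node k _ ts) = suc (depths ts)

  depths : ∀ {n m} → Vec (Tree n) m → ℕ
  depths [] = 0
  depths (t ∷ ts) = depth t ⊔ depths ts

mutual
  count : ∀ {n} → ℕ → Tree n → ℕ
  count j (node k _ ts) with k ≟ j
  ... | yes _ = suc (counts j ts)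
  ... | no _ = counts j ts

  counts : ∀ {n m} → ℕ → Vec (Tree n) m → ℕ
  counts j [] = 0
  counts j (t ∷ ts) = count j t + counts j ts

T : ∀ {n} (k : ℕ) → k ≤ n → Tree n
T zero p = node zero p []
T (suc k) p = node (suc k) p (replicate (suc k) (T k (≤-trans (n≤1+n k) p)))

factQuot : ℕ → ℕ → ℕ
factQuot n k = _/_ (n !) (k !) {{k !≢0}}

InTrees : (n : ℕ) → Tree n → Set
InTrees n t = depth t ≤ suc n
  × (∀ k → 2 ≤ k → k ≤ n → count k t ≡ factQuot n k)

{-# OPTIONS --safe #-}
module Submission where

-- Give a node of arity k the potential α(k+1) − k·α(k), where α(i) = δ 0 + ⋯ + δ (i − 1) and the
-- increments satisfy i·δ(i) < δ(i+1) < (i+1)·δ(i).  A tree of depth ≤ e + 1 has total potential at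
-- most α(e+1), with equality only for T_e: below a root of arity k the children contribute at most
-- k·α(e), and k ↦ α(k+1) − k·α(k) + k·α(e) is uniquely maximised, with value α(e+1), at k = e.
-- Nodes N₀ and N₁ both have potential 2, so potential minus twice the size only depends on the
-- numbers of nodes N_k with k ≥ 2.  On Trees(n) a tree at least as large as T_n therefore has
-- potential at least that of T_n, which forces it to be T_n.

open import Defs
open import Data.Nat using (ℕ; zero; suc; _+_; _*_; _∸_; _/_; _≤_; _<_; z≤n; s≤s; _≟_; _!)
open import Data.Nat.DivMod using (m*n/n≡m)
open import Data.Nat.Properties
open import Data.Nat.Tactic.RingSolver using (solve-∀)
open import Algebra.Properties.CommutativeSemigroup +-commutativeSemigroup using (interchange; xy∙z≈xz∙y; xy∙z≈y∙xz)
open import Data.Product using (_×_; _,_; proj₂)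
open import Data.Sum using (inj₁; inj₂)
open import Function using (id)
open import Data.Vec using (Vec; []; _∷_; replicate)
open import Relation.Nullary using (yes; no; contradiction)
open import Relation.Binary.PropositionalEquality

record Gap (x y : ℕ) (P : Set) : Set where
  constructor mkGap
  field
    gap       : ℕ
    x+gap≡y   : x + gap ≡ y
    gap≡0⇒P   : gap ≡ 0 → P

Gap-cong : ∀ {x x′ y y′ P Q} → x ≡ x′ → y ≡ y′ → (P → Q) → Gap x y P → Gap x′ y′ Q
Gap-cong refl refl P⇒Q (mkGap g eq tight) = mkGap g eq (λ g≡0 → P⇒Q (tight g≡0))

Gap-exact : ∀ {x P} → P → Gap x x P
Gap-exact {x} p = mkGap 0 (+-identityʳ x) (λ _ → p)

Gap-+ : ∀ {x₁ y₁ x₂ y₂ P Q} → Gap x₁ y₁ P → Gap x₂ y₂ Q → Gap (x₁ + x₂) (y₁ + y₂) (P × Q)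
Gap-+ {x₁} {x₂ = x₂} (mkGap g₁ eq₁ tight₁) (mkGap g₂ eq₂ tight₂) =
  mkGap (g₁ + g₂) (trans (interchange x₁ x₂ g₁ g₂) (cong₂ _+_ eq₁ eq₂))
        (λ g≡0 → tight₁ (m+n≡0⇒m≡0 g₁ g≡0) , tight₂ (m+n≡0⇒n≡0 g₁ g≡0))

Gap-+ˡ : ∀ c {x y P} → Gap x y P → Gap (c + x) (c + y) P
Gap-+ˡ c {x} (mkGap g eq tight) = mkGap g (trans (+-assoc c x g) (cong (c +_) eq)) tight

Gap-+ʳ : ∀ c {x y P} → Gap x y P → Gap (x + c) (y + c) P
Gap-+ʳ c {x} {y} g = Gap-cong (+-comm c x) (+-comm c y) id (Gap-+ˡ c g)

Gap-trans : ∀ {x y z P Q} → Gap x y P → Gap y z Q → Gap x z (P × Q)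
Gap-trans {x} (mkGap g₁ eq₁ tight₁) (mkGap g₂ eq₂ tight₂) =
  mkGap (g₁ + g₂) (trans (sym (+-assoc x g₁ g₂)) (trans (cong (_+ g₂) eq₁) eq₂))
        (λ g≡0 → tight₁ (m+n≡0⇒m≡0 g₁ g≡0) , tight₂ (m+n≡0⇒n≡0 g₁ g≡0))

Gap-≤ : ∀ {x y r} → x + r ≤ y → Gap x y (r ≡ 0)
Gap-≤ {x} {y} {r} x+r≤y =
  mkGap (r + (y ∸ (x + r))) (trans (sym (+-assoc x r _)) (m+[n∸m]≡n x+r≤y)) (m+n≡0⇒m≡0 r)

Gap-tight : ∀ {x y P} → Gap x y P → y ≤ x → P
Gap-tight {x} (mkGap g refl tight) x+g≤x =
  tight (n≤0⇒n≡0 (+-cancelˡ-≤ x g 0 (subst (x + g ≤_) (sym (+-identityʳ x)) x+g≤x)))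

∑< : ℕ → (ℕ → ℕ) → ℕ
∑< zero f = 0
∑< (suc m) f = ∑< m f + f m

syntax ∑< m (λ j → e) = ∑[ j < m ] e

∑-cong : ∀ m {f g : ℕ → ℕ} → (∀ j → j < m → f j ≡ g j) → ∑< m f ≡ ∑< m g
∑-cong zero f≡g = refl
∑-cong (suc m) f≡g = cong₂ _+_ (∑-cong m (λ j j<m → f≡g j (m<n⇒m<1+n j<m))) (f≡g m (n<1+n m))

∑-zero : ∀ m → ∑[ j < m ] 0 ≡ 0
∑-zero zero = refl
∑-zero (suc m) = trans (+-identityʳ _) (∑-zero m)

∑-distrib-+ : ∀ m (f g : ℕ → ℕ) → ∑[ j < m ] (f j + g j) ≡ ∑< m f + ∑< m g
∑-distrib-+ zero f g = refl
∑-distrib-+ (suc m) f g = trans (cong (_+ (f m + g m)) (∑-distrib-+ m f g)) (interchange (∑< m f) (∑< m g) (f m) (g m))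

mutual
  weight : ∀ {n} → (ℕ → ℕ) → Tree n → ℕ
  weight w (node k _ ts) = w k + weights w ts

  weights : ∀ {n m} → (ℕ → ℕ) → Vec (Tree n) m → ℕ
  weights w [] = 0
  weights w (t ∷ ts) = weight w t + weights w ts

weights-replicate : ∀ {n} w m (t : Tree n) → weights w (replicate m t) ≡ m * weight w t
weights-replicate w zero t = refl
weights-replicate w (suc m) t = cong (weight w t +_) (weights-replicate w m t)

mutual
  weight-+const : ∀ {n} w c (t : Tree n) → weight (λ k → w k + c) t ≡ weight w t + c * size t
  weight-+const w c (node k _ ts) =
    trans (cong (w k + c +_) (weights-+const w c ts))
          (trans (interchange (w k) c (weights w ts) (c * sizes ts)) (cong (w k + weights w ts +_) (sym (*-suc c (sizes ts)))))

  weights-+const : ∀ {n m} w c (ts : Vec (Tree n) m) → weights (λ k → w k + c) ts ≡ weights w ts + c * sizes ts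
  weights-+const w c [] = sym (*-zeroʳ c)
  weights-+const w c (t ∷ ts) =
    trans (cong₂ _+_ (weight-+const w c t) (weights-+const w c ts))
          (trans (interchange (weight w t) (c * size t) (weights w ts) (c * sizes ts))
                 (cong (weight w t + weights w ts +_) (sym (*-distribˡ-+ c (size t) (sizes ts)))))

𝟙[_≡_] : ℕ → ℕ → ℕ
𝟙[ k ≡ j ] with k ≟ j
... | yes _ = 1
... | no _ = 0

𝟙-refl : ∀ k → 𝟙[ k ≡ k ] ≡ 1
𝟙-refl k with k ≟ k
... | yes _ = refl
... | no k≢k = contradiction refl k≢k

𝟙-≢ : ∀ {k j} → k ≢ j → 𝟙[ k ≡ j ] ≡ 0
𝟙-≢ {k} {j} k≢j with k ≟ j
... | yes k≡j = contradiction k≡j k≢j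
... | no _ = refl

count-node : ∀ {n} j k (q : k ≤ n) ts → count j (node k q ts) ≡ 𝟙[ k ≡ j ] + counts j ts
count-node j k q ts with k ≟ j
... | yes _ = refl
... | no _ = refl

*𝟙-≢ : ∀ x {k j} → k ≢ j → x * 𝟙[ k ≡ j ] ≡ 0
*𝟙-≢ x k≢j = trans (cong (x *_) (𝟙-≢ k≢j)) (*-zeroʳ x)

∑-𝟙 : ∀ (f : ℕ → ℕ) {k} m → k < m → ∑[ j < m ] (f j * 𝟙[ k ≡ j ]) ≡ f k
∑-𝟙 f {k} (suc m) k<1+m with m≤n⇒m<n∨m≡n (≤-pred k<1+m)
... | inj₁ k<m = trans (cong₂ _+_ (∑-𝟙 f m k<m) (*𝟙-≢ (f m) (<⇒≢ k<m))) (+-identityʳ (f k))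
... | inj₂ refl = cong₂ _+_
  (trans (∑-cong k (λ j j<k → *𝟙-≢ (f j) (≢-sym (<⇒≢ j<k)))) (∑-zero k))
  (trans (cong (f k *_) (𝟙-refl k)) (*-identityʳ (f k)))

mutual
  weight-∑ : ∀ {n} w (t : Tree n) → weight w t ≡ ∑[ j < suc n ] (w j * count j t)
  weight-∑ {n} w (node k q ts) = begin
    w k + weights w ts
      ≡⟨ cong₂ _+_ (sym (∑-𝟙 w (suc n) (s≤s q))) (weights-∑ w ts) ⟩
    ∑[ j < suc n ] (w j * 𝟙[ k ≡ j ]) + ∑[ j < suc n ] (w j * counts j ts)
      ≡⟨ ∑-distrib-+ (suc n) _ _ ⟨
    ∑[ j < suc n ] (w j * 𝟙[ k ≡ j ] + w j * counts j ts)
      ≡⟨ ∑-cong (suc n) (λ j _ → trans (sym (*-distribˡ-+ (w j) _ _)) (cong (w j *_) (sym (count-node j k q ts)))) ⟩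
    ∑[ j < suc n ] (w j * count j (node k q ts))
      ∎
    where open ≡-Reasoning

  weights-∑ : ∀ {n m} w (ts : Vec (Tree n) m) → weights w ts ≡ ∑[ j < suc n ] (w j * counts j ts)
  weights-∑ {n} w [] = sym (trans (∑-cong (suc n) (λ j _ → *-zeroʳ (w j))) (∑-zero (suc n)))
  weights-∑ {n} w (t ∷ ts) = begin
    weight w t + weights w ts
      ≡⟨ cong₂ _+_ (weight-∑ w t) (weights-∑ w ts) ⟩
    ∑[ j < suc n ] (w j * count j t) + ∑[ j < suc n ] (w j * counts j ts)
      ≡⟨ ∑-distrib-+ (suc n) _ _ ⟨
    ∑[ j < suc n ] (w j * count j t + w j * counts j ts)
      ≡⟨ ∑-cong (suc n) (λ j _ → sym (*-distribˡ-+ (w j) _ _)) ⟩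
    ∑[ j < suc n ] (w j * counts j (t ∷ ts))
      ∎
    where open ≡-Reasoning

weight-exchange : ∀ {n} (f g : ℕ → ℕ) (t u : Tree n) → f 0 ≡ g 0 → f 1 ≡ g 1 →
                  (∀ k → 2 ≤ k → k ≤ n → count k t ≡ count k u) →
                  weight f t + weight g u ≡ weight f u + weight g t
weight-exchange {n} f g t u f0≡g0 f1≡g1 same-counts = begin
  weight f t + weight g u                                          ≡⟨ cong₂ _+_ (weight-∑ f t) (weight-∑ g u) ⟩
  ∑[ j < suc n ] (f j * count j t) + ∑[ j < suc n ] (g j * count j u)  ≡⟨ ∑-distrib-+ (suc n) _ _ ⟨
  ∑[ j < suc n ] (f j * count j t + g j * count j u)               ≡⟨ ∑-cong (suc n) exchange ⟩
  ∑[ j < suc n ] (f j * count j u + g j * count j t)               ≡⟨ ∑-distrib-+ (suc n) _ _ ⟩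
  ∑[ j < suc n ] (f j * count j u) + ∑[ j < suc n ] (g j * count j t)  ≡⟨ cong₂ _+_ (weight-∑ f u) (weight-∑ g t) ⟨
  weight f u + weight g t                                          ∎
  where
    open ≡-Reasoning
    swap : ∀ {a b} x y → a ≡ b → a * x + b * y ≡ a * y + b * x
    swap {a} x y refl = +-comm (a * x) (a * y)
    exchange : ∀ j → j < suc n → f j * count j t + g j * count j u ≡ f j * count j u + g j * count j t
    exchange zero _ = swap (count 0 t) (count 0 u) f0≡g0
    exchange (suc zero) _ = swap (count 1 t) (count 1 u) f1≡g1
    exchange (suc (suc j)) (s≤s j≤n) = cong₂ (λ x y → f (suc (suc j)) * x + g (suc (suc j)) * y) c≡ (sym c≡)
      where c≡ = same-counts (suc (suc j)) (s≤s (s≤s z≤n)) j≤n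

-- δ 0 = δ 1 gives N₀ and N₁ the same potential; the recursion keeps i·δ i < δ (1+i) < (1+i)·δ i.
δ : ℕ → ℕ
δ zero = 2
δ (suc zero) = 2
δ (suc (suc i)) = suc (suc i * δ (suc i))

α : ℕ → ℕ
α zero = 0
α (suc i) = α i + δ i

2≤δ[1+i] : ∀ i → 2 ≤ δ (suc i)
2≤δ[1+i] zero = ≤-refl
2≤δ[1+i] (suc i) = s≤s (≤-trans (≤-trans (s≤s z≤n) (2≤δ[1+i] i)) (m≤n*m (δ (suc i)) (suc i)))

i*δi<δ[1+i] : ∀ i → i * δ i < δ (suc i)
i*δi<δ[1+i] zero = s≤s z≤n
i*δi<δ[1+i] (suc i) = ≤-refl

δ[1+i]<[1+i]*δi : ∀ i → 1 ≤ i → δ (suc i) < suc i * δ i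
δ[1+i]<[1+i]*δi (suc i) _ = +-monoˡ-≤ (suc i * δ (suc i)) (2≤δ[1+i] i)

k*δi<δ[1+i] : ∀ {k i} → k ≤ i → k * δ i < δ (suc i)
k*δi<δ[1+i] {k} {i} k≤i = ≤-trans (s≤s (*-monoˡ-≤ (δ i) k≤i)) (i*δi<δ[1+i] i)

δ[1+i]<k*δi : ∀ {k i} → 1 ≤ i → suc i ≤ k → δ (suc i) < k * δ i
δ[1+i]<k*δi {k} {i} 1≤i 1+i≤k = ≤-trans (δ[1+i]<[1+i]*δi i 1≤i) (*-monoˡ-≤ (δ i) 1+i≤k)

α-peak-below : ∀ k r → k * α (r + k) + α (suc k) + r ≤ α (suc (r + k)) + k * α k
α-peak-below k zero = ≤-reflexive (trans (+-identityʳ _) (+-comm (k * α k) (α (suc k))))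
α-peak-below k (suc r) = begin
  k * (α (r + k) + δ (r + k)) + α (suc k) + suc r        ≡⟨ regroup k (α (r + k)) (δ (r + k)) (α (suc k)) r ⟩
  (k * α (r + k) + α (suc k) + r) + suc (k * δ (r + k))  ≤⟨ +-mono-≤ (α-peak-below k r) (k*δi<δ[1+i] (m≤n+m k r)) ⟩
  (α (suc (r + k)) + k * α k) + δ (suc (r + k))          ≡⟨ xy∙z≈xz∙y (α (suc (r + k))) (k * α k) _ ⟩
  α (suc (suc r + k)) + k * α k                          ∎
  where
    open ≤-Reasoning
    regroup : ∀ k a d b r → k * (a + d) + b + suc r ≡ (k * a + b + r) + suc (k * d)
    regroup = solve-∀

α-peak-above : ∀ k m r → 1 ≤ m → r + m ≤ k → k * α m + α (suc (r + m)) + r ≤ α (suc m) + k * α (r + m)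
α-peak-above k m zero _ _ = ≤-reflexive (trans (+-identityʳ _) (+-comm (k * α m) (α (suc m))))
α-peak-above k m (suc r) 1≤m 1+r+m≤k = begin
  k * α m + (α (suc (r + m)) + δ (suc (r + m))) + suc r
    ≡⟨ regroup (k * α m) (α (suc (r + m))) (δ (suc (r + m))) r ⟩
  (k * α m + α (suc (r + m)) + r) + suc (δ (suc (r + m)))
    ≤⟨ +-mono-≤ (α-peak-above k m r 1≤m (≤-trans (n≤1+n _) 1+r+m≤k))
                (δ[1+i]<k*δi (≤-trans 1≤m (m≤n+m m r)) 1+r+m≤k) ⟩
  (α (suc m) + k * α (r + m)) + k * δ (r + m)
    ≡⟨ trans (+-assoc (α (suc m)) _ _) (cong (α (suc m) +_) (sym (*-distribˡ-+ k _ _))) ⟩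
  α (suc m) + k * α (suc r + m)
    ∎
  where
    open ≤-Reasoning
    regroup : ∀ a b c r → a + (b + c) + suc r ≡ (a + b + r) + suc c
    regroup = solve-∀

α-peak : ∀ m k → 1 ≤ m → Gap (k * α m + α (suc k)) (α (suc m) + k * α k) (k ≡ m)
α-peak m k 1≤m with ≤-total k m
... | inj₁ k≤m = Gap-cong refl refl (λ r≡0 → trans (cong (_+ k) (sym r≡0)) r+k≡m) (Gap-≤ below)
  where
    r = m ∸ k
    r+k≡m : r + k ≡ m
    r+k≡m = m∸n+n≡m k≤m
    below : k * α m + α (suc k) + r ≤ α (suc m) + k * α k
    below = subst (λ z → k * α z + α (suc k) + r ≤ α (suc z) + k * α k) r+k≡m (α-peak-below k r)
... | inj₂ m≤k = Gap-cong refl refl (λ r≡0 → trans (sym r+m≡k) (cong (_+ m) r≡0)) (Gap-≤ above)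
  where
    r = k ∸ m
    r+m≡k : r + m ≡ k
    r+m≡k = m∸n+n≡m m≤k
    above : k * α m + α (suc k) + r ≤ α (suc m) + k * α k
    above = subst (λ z → k * α m + α (suc z) + r ≤ α (suc m) + k * α z) r+m≡k
                  (α-peak-above k m r 1≤m (≤-reflexive r+m≡k))

-- The potential α⁺ k − kα k can be negative, so it is only ever used with its two parts on
-- opposite sides of an (in)equality.
α⁺ : ℕ → ℕ
α⁺ k = α (suc k)

kα : ℕ → ℕ
kα k = k * α k

node≡T : ∀ {n e k} (p : suc e ≤ n) (q : k ≤ n) {ts : Vec (Tree n) k} →
         ts ≡ replicate k (T e (≤-trans (n≤1+n e) p)) → k ≡ suc e → node k q ts ≡ T (suc e) p
node≡T p q refl refl = cong (λ r → node _ r _) (≤-irrelevant q p)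

mutual
  weight-bound : ∀ {n} e (p : e ≤ n) (t : Tree n) → depth t ≤ suc e →
                 Gap (weight α⁺ t) (α (suc e) + weight kα t) (t ≡ T e p)
  weight-bound zero p (node zero q []) _ = Gap-exact (cong (λ r → node zero r []) (≤-irrelevant q p))
  weight-bound zero p (node (suc k) q (node _ _ us ∷ ts)) (s≤s d) with () ← m⊔n≤o⇒m≤o (suc (depths us)) (depths ts) d
  weight-bound (suc e) p (node k q ts) (s≤s d) =
    Gap-cong refl refl (λ (ts≡ , k≡) → node≡T p q ts≡ k≡) (Gap-trans children root)
    where
      children : Gap (α⁺ k + weights α⁺ ts) (α⁺ k + (k * α (suc e) + weights kα ts))
                     (ts ≡ replicate k (T e (≤-trans (n≤1+n e) p)))
      children = Gap-+ˡ (α⁺ k) (weights-bound e _ k ts d)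
      root : Gap (α⁺ k + (k * α (suc e) + weights kα ts)) (α (suc (suc e)) + (kα k + weights kα ts)) (k ≡ suc e)
      root = Gap-cong (xy∙z≈y∙xz (k * α (suc e)) (α⁺ k) (weights kα ts)) (+-assoc (α (suc (suc e))) _ _)
                      id (Gap-+ʳ (weights kα ts) (α-peak (suc e) k (s≤s z≤n)))

  weights-bound : ∀ {n} e (p : e ≤ n) m (ts : Vec (Tree n) m) → depths ts ≤ suc e →
                  Gap (weights α⁺ ts) (m * α (suc e) + weights kα ts) (ts ≡ replicate m (T e p))
  weights-bound e p zero [] _ = Gap-exact refl
  weights-bound e p (suc m) (t ∷ ts) d =
    Gap-cong refl (interchange (α (suc e)) _ _ _) (λ (t≡ , ts≡) → cong₂ _∷_ t≡ ts≡)
      (Gap-+ (weight-bound e p t (m⊔n≤o⇒m≤o _ _ d)) (weights-bound e p m ts (m⊔n≤o⇒n≤o _ _ d)))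

weight-T : ∀ {n} e (p : e ≤ n) → weight α⁺ (T e p) ≡ α (suc e) + weight kα (T e p)
weight-T zero p = refl
weight-T (suc e) p = begin
  α⁺ (suc e) + weights α⁺ (replicate (suc e) t)
    ≡⟨ cong (α⁺ (suc e) +_) (weights-replicate α⁺ (suc e) t) ⟩
  α⁺ (suc e) + suc e * weight α⁺ t
    ≡⟨ cong (λ x → α⁺ (suc e) + suc e * x) (weight-T e _) ⟩
  α⁺ (suc e) + suc e * (α (suc e) + weight kα t)
    ≡⟨ cong (α⁺ (suc e) +_) (*-distribˡ-+ (suc e) (α (suc e)) (weight kα t)) ⟩
  α⁺ (suc e) + (kα (suc e) + suc e * weight kα t)
    ≡⟨ cong (λ x → α⁺ (suc e) + (kα (suc e) + x)) (weights-replicate kα (suc e) t) ⟨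
  α⁺ (suc e) + weight kα (T (suc e) p)
    ∎
  where
    open ≡-Reasoning
    t = T e (≤-trans (n≤1+n e) p)

depths-replicate : ∀ {n} m (t : Tree n) → depths (replicate m t) ≤ depth t
depths-replicate zero t = z≤n
depths-replicate (suc m) t = ⊔-lub ≤-refl (depths-replicate m t)

depth-T : ∀ {n} e (p : e ≤ n) → depth (T e p) ≤ suc e
depth-T zero p = ≤-refl
depth-T (suc e) p = s≤s (≤-trans (depths-replicate (suc e) _) (depth-T e _))

counts-replicate : ∀ {n} j m (t : Tree n) → counts j (replicate m t) ≡ m * count j t
counts-replicate j zero t = refl
counts-replicate j (suc m) t = cong (count j t +_) (counts-replicate j m t)

count-T-suc : ∀ {n} j e (p : suc e ≤ n) →
              count j (T (suc e) p) ≡ 𝟙[ suc e ≡ j ] + suc e * count j (T e (≤-trans (n≤1+n e) p))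
count-T-suc j e p = trans (count-node j (suc e) p _) (cong (𝟙[ suc e ≡ j ] +_) (counts-replicate j (suc e) _))

count-T-above : ∀ {n} e (p : e ≤ n) {k} → e < k → count k (T e p) ≡ 0
count-T-above zero p e<k = trans (count-node _ zero p []) (cong (_+ 0) (𝟙-≢ (<⇒≢ e<k)))
count-T-above (suc e) p {k} e<k = begin
  count k (T (suc e) p)                      ≡⟨ count-T-suc k e p ⟩
  𝟙[ suc e ≡ k ] + suc e * count k (T e p′)  ≡⟨ cong₂ (λ x y → x + suc e * y) (𝟙-≢ (<⇒≢ e<k))
                                                      (count-T-above e p′ (<-trans (n<1+n e) e<k)) ⟩
  suc e * 0                                  ≡⟨ *-zeroʳ (suc e) ⟩
  0                                          ∎
  where
    open ≡-Reasoning
    p′ = ≤-trans (n≤1+n e) p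

count-T : ∀ {n} e (p : e ≤ n) {k} → k ≤ e → count k (T e p) * k ! ≡ e !
count-T zero p z≤n = refl
count-T (suc e) p {k} k≤1+e with k ≟ suc e
... | yes refl = begin
  count (suc e) (T (suc e) p) * suc e !                     ≡⟨ cong (_* suc e !) (count-T-suc (suc e) e p) ⟩
  (𝟙[ suc e ≡ suc e ] + suc e * count (suc e) t) * suc e !  ≡⟨ cong₂ (λ x y → (x + suc e * y) * suc e !) (𝟙-refl (suc e))
                                                                     (count-T-above e p′ (n<1+n e)) ⟩
  (1 + suc e * 0) * suc e !                                 ≡⟨ cong (λ x → (1 + x) * suc e !) (*-zeroʳ (suc e)) ⟩
  1 * suc e !                                               ≡⟨ *-identityˡ (suc e !) ⟩
  suc e !                                                   ∎
  where
    open ≡-Reasoning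
    p′ = ≤-trans (n≤1+n e) p
    t = T e p′
... | no k≢1+e = begin
  count k (T (suc e) p) * k !                 ≡⟨ cong (_* k !) (count-T-suc k e p) ⟩
  (𝟙[ suc e ≡ k ] + suc e * count k t) * k !  ≡⟨ cong (λ x → (x + suc e * count k t) * k !) (𝟙-≢ (≢-sym k≢1+e)) ⟩
  (suc e * count k t) * k !                   ≡⟨ *-assoc (suc e) (count k t) (k !) ⟩
  suc e * (count k t * k !)                   ≡⟨ cong (suc e *_) (count-T e p′ (≤-pred (≤∧≢⇒< k≤1+e k≢1+e))) ⟩
  suc e !                                     ∎
  where
    open ≡-Reasoning
    p′ = ≤-trans (n≤1+n e) p
    t = T e p′

T∈Trees : ∀ n → InTrees n (T n ≤-refl)
T∈Trees n = depth-T n ≤-refl , count≡factQuot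
  where
    count≡factQuot : ∀ k → 2 ≤ k → k ≤ n → count k (T n ≤-refl) ≡ factQuot n k
    count≡factQuot k _ k≤n = begin
      count k (T n ≤-refl)                 ≡⟨ m*n/n≡m _ (k !) ⟨
      count k (T n ≤-refl) * k ! / k !     ≡⟨ cong (_/ k !) (count-T n ≤-refl k≤n) ⟩
      n ! / k !                            ∎
      where
        open ≡-Reasoning
        instance
          _ = k !≢0

lemma57 : (n : ℕ) (t : Tree n) → InTrees n t
    → (∀ (s : Tree n) → InTrees n s → size s ≤ size t)
    → t ≡ T n ≤-refl
lemma57 n t (depth≤ , same-counts) maximal = Gap-tight (weight-bound n ≤-refl t depth≤) bound-attained
  where
    Tₙ = T n ≤-refl
    κ : ℕ → ℕ
    κ k = kα k + 2
    balance : weight α⁺ t + weight κ Tₙ ≡ weight α⁺ Tₙ + weight κ t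
    balance = weight-exchange α⁺ κ t Tₙ refl refl
                (λ k 2≤k k≤n → trans (same-counts k 2≤k k≤n) (sym (proj₂ (T∈Trees n) k 2≤k k≤n)))
    bound-attained : α (suc n) + weight kα t ≤ weight α⁺ t
    bound-attained = +-cancelʳ-≤ (weight κ Tₙ) _ _ (begin
      α (suc n) + weight kα t + weight κ Tₙ
        ≡⟨ cong (α (suc n) + weight kα t +_) (weight-+const kα 2 Tₙ) ⟩
      α (suc n) + weight kα t + (weight kα Tₙ + 2 * size Tₙ)
        ≤⟨ +-monoʳ-≤ (α (suc n) + weight kα t) (+-monoʳ-≤ (weight kα Tₙ) (*-monoʳ-≤ 2 (maximal Tₙ (T∈Trees n)))) ⟩
      α (suc n) + weight kα t + (weight kα Tₙ + 2 * size t)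
        ≡⟨ interchange (α (suc n)) _ _ _ ⟩
      α (suc n) + weight kα Tₙ + (weight kα t + 2 * size t)
        ≡⟨ cong₂ _+_ (weight-T n ≤-refl) (weight-+const kα 2 t) ⟨
      weight α⁺ Tₙ + weight κ t
        ≡⟨ balance ⟨
      weight α⁺ t + weight κ Tₙ
        ∎)
      where open ≤-Reasoning
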